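{- A tree $T$ admits an odd caterpillar factor if and only if the spanning subgraph of $T$ with edge set $E'=\{e\in E(T)\mid T-e \text{ has two odd components}\}$ is an odd caterpillar factor of $T$ (i.e., each of its components is an odd caterpillar).
   Context: A caterpillar is a simple graph with at least one edge consisting of a path of order at least $1$ together with some (possibly zero) leaves adjacent to vertices of the path. A caterpillar is odd if every vertex of degree at least $2$ in it has odd degree; $K_2$ is an odd caterpillar. For a simple graph $G$, an odd caterpillar factor of $G$ is a set of subgraphs of $G$, each an odd caterpillar, such that each vertex of $G$ belongs to exactly one of them. A component is odd if its number of vertices is odd. -}

module Defs where

open import Data.Nat using (ℕ; zero; suc; _+_; _*_; _≤_)
open import Data.Fin using (Fin)
open import Data.List using (List; []; _∷_; _++_; length; [_])
open import Data.List.Membership.Propositional using (_∈_; _∉_)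
open import Data.List.Relation.Unary.All using (All)
open import Data.List.Relation.Unary.Linked using (Linked)
open import Data.List.Relation.Unary.Unique.Propositional using (Unique)
open import Data.Product using (Σ; ∃; ∃-syntax; _×_; _,_; proj₁; proj₂)
open import Data.Sum using (_⊎_; inj₁; inj₂)
open import Function.Bundles using (_⇔_; mk⇔; Equivalence)
open import Relation.Nullary using (¬_)
open import Relation.Binary.PropositionalEquality using (_≡_; refl)

Odd : ℕ → Set
Odd m = ∃[ k ] m ≡ suc (2 * k)

record Graph (n : ℕ) : Set₁ where
  field
    Adj    : Fin n → Fin n → Set
    sym    : ∀ {u v} → Adj u v → Adj v u
    irrefl : ∀ {v} → ¬ Adj v v
open Graph public

module _ {n : ℕ} where

  data Reach (G : Graph n) : Fin n → Fin n → Set where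
    here : ∀ {u} → Reach G u u
    step : ∀ {u v w} → Adj G u v → Reach G v w → Reach G u w

  Connected : Graph n → Set
  Connected G = ∀ u v → Reach G u v

  -- a cycle: distinct vertices x, y₁, …, y_k (k ≥ 2), consecutive ones adjacent,
  -- and y_k adjacent to x
  HasCycle : Graph n → Set
  HasCycle G = ∃[ x ] ∃[ ys ] (2 ≤ length ys × Unique (x ∷ ys)
                               × Linked (Adj G) (x ∷ ys ++ [ x ]))

  IsTree : Graph n → Set
  IsTree G = Connected G × ¬ HasCycle G

  HasDeg : Graph n → Fin n → ℕ → Set
  HasDeg G v d = ∃[ L ] (Unique L × (∀ u → (u ∈ L) ⇔ Adj G v u) × length L ≡ d)

  OddComponent : Graph n → Fin n → Set
  OddComponent G x = ∃[ L ] (Unique L × (∀ y → (y ∈ L) ⇔ Reach G x y) × Odd (length L))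

  HasTwoOddComponents : Graph n → Set
  HasTwoOddComponents G =
    ∃[ x ] ∃[ y ] (¬ Reach G x y × OddComponent G x × OddComponent G y)

  Consecutive : List (Fin n) → Fin n → Fin n → Set
  Consecutive P a b = ∃[ xs ] ∃[ ys ] (P ≡ xs ++ a ∷ b ∷ ys ⊎ P ≡ xs ++ b ∷ a ∷ ys)

  -- The component of F containing v is an odd caterpillar:
  --  * it has at least one edge;
  --  * there is a path P (nonempty list of distinct vertices of the component,
  --    consecutive ones adjacent, and no other adjacencies among them) such that
  --    every other vertex of the component is a leaf (degree 1) adjacent to P;
  --  * every vertex of degree at least 2 has odd degree.
  IsOddCaterpillarComponent : Graph n → Fin n → Set
  IsOddCaterpillarComponent F v =
    (∃[ u ] ∃[ w ] (Reach F v u × Adj F u w))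
    × (∃[ P ] (¬ P ≡ [] × Unique P × Linked (Adj F) P × All (Reach F v) P
               × (∀ a b → a ∈ P → b ∈ P → Adj F a b → Consecutive P a b)
               × (∀ u → Reach F v u → u ∉ P →
                    HasDeg F u 1 × ∃[ w ] (w ∈ P × Adj F u w))))
    × (∀ u d → Reach F v u → HasDeg F u d → 2 ≤ d → Odd d)

  SpanningSubgraph : Graph n → Graph n → Set
  SpanningSubgraph F G = ∀ {u v} → Adj F u v → Adj G u v

  IsOddCaterpillarFactor : Graph n → Graph n → Set
  IsOddCaterpillarFactor G F = SpanningSubgraph F G × (∀ v → IsOddCaterpillarComponent F v)

  HasOddCaterpillarFactor : Graph n → Set₁
  HasOddCaterpillarFactor G = ∃[ F ] IsOddCaterpillarFactor G F

  SameEdge : Fin n → Fin n → Fin n → Fin n → Set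
  SameEdge a b x y = (x ≡ a × y ≡ b) ⊎ (x ≡ b × y ≡ a)

  deleteEdge : Graph n → Fin n → Fin n → Graph n
  deleteEdge G a b = record
    { Adj    = λ x y → Adj G x y × ¬ SameEdge a b x y
    ; sym    = λ { (e , ns) → sym G e , λ { (inj₁ (p , q)) → ns (inj₂ (q , p))
                                          ; (inj₂ (p , q)) → ns (inj₁ (q , p)) } }
    ; irrefl = λ { (e , _) → irrefl G e }
    }

  private
    swapSame : ∀ {a b x y} → SameEdge b a x y → SameEdge a b x y
    swapSame (inj₁ p) = inj₂ p
    swapSame (inj₂ p) = inj₁ p

    reachSwap : ∀ G {a b x y} → Reach (deleteEdge G a b) x y → Reach (deleteEdge G b a) x y
    reachSwap G here = here
    reachSwap G (step (e , ns) r) = step (e , (λ s → ns (swapSame s))) (reachSwap G r)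

    oddSwap : ∀ G {a b x} → OddComponent (deleteEdge G a b) x → OddComponent (deleteEdge G b a) x
    oddSwap G (L , u , f , o) = L , u , (λ y → mk⇔
      (λ m → reachSwap G (Equivalence.to (f y) m))
      (λ r → Equivalence.from (f y) (reachSwap G r))) , o

    twoSwap : ∀ G {a b} → HasTwoOddComponents (deleteEdge G a b)
                        → HasTwoOddComponents (deleteEdge G b a)
    twoSwap G (x , y , nr , ox , oy) =
      x , y , (λ r → nr (reachSwap G r)) , oddSwap G ox , oddSwap G oy

  oddCutSubgraph : Graph n → Graph n
  oddCutSubgraph T = record
    { Adj    = λ a b → Adj T a b × HasTwoOddComponents (deleteEdge T a b)
    ; sym    = λ { (e , h) → sym T e , twoSwap T h }
    ; irrefl = λ { (e , _) → irrefl T e }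
    }

module Submission where

-- The direction "⇐" is immediate (E′ is a witness).  For "⇒" we show that any odd
-- caterpillar factor F of T has exactly the edges of E′; being an odd caterpillar is
-- invariant under replacing F by a graph with the same adjacency, so E′ inherits it.
-- The only property of F used is that it is an "odd factor": every vertex has odd
-- degree in F.  For an edge ab of T let A be the side of a in T - ab.  Counting
-- F-degrees over A modulo 2 (a handshake lemma restricted to A) gives
--     |A| ≡ Σ_{u ∈ A} deg_F u ≡ #(F-edges leaving A) = [ab ∈ F]   (mod 2),
-- because ab is the only edge of T between A and its complement.  Hence ab ∈ F iff
-- the side of a (and likewise the side of b) is odd, i.e. iff ab ∈ E′.

open import Defs hiding (sym)
open import Data.Nat using (ℕ; zero; suc; _+_; z≤n; s≤s)
open import Data.Nat.Properties using (+-suc; +-identityʳ)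
open import Data.Fin using (Fin; zero; suc; _≟_; punchIn)
open import Data.Fin.Properties using (punchInᵢ≢i)
open import Data.Bool using (Bool; true; false; not; _∧_; _∨_; _xor_)
open import Data.Bool.Properties
  using (not-involutive; xor-∧-commutativeRing; xor-identityʳ; xor-same; ¬-not; ∧-identityʳ)
open import Data.Maybe using (just)
open import Data.Maybe.Properties using (just-injective)
open import Data.Maybe.Relation.Binary.Connected as Maybe using (just)
open import Data.List using (List; []; _∷_; _++_; [_]; length; last; filter; allFin)
open import Data.List.Properties using (∷-injectiveʳ)
open import Data.List.Membership.Propositional using (_∈_)
open import Data.List.Membership.Propositional.Properties using (∈-filter⁺; ∈-filter⁻; ∈-allFin)
import Data.List.Membership.DecPropositional as DecMembership
open import Data.List.Relation.Unary.Any using (here; there)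
open import Data.List.Relation.Unary.All as All using ([]; lookup)
open import Data.List.Relation.Unary.All.Properties using (¬Any⇒All¬)
open import Data.List.Relation.Unary.Linked as Linked using (Linked; []; [-]; _∷_)
open import Data.List.Relation.Unary.Linked.Properties using (++⁺)
open import Data.List.Relation.Unary.Unique.Propositional using (Unique; []; _∷_)
open import Data.List.Relation.Unary.Unique.Propositional.Properties using (filter⁺; allFin⁺)
open import Data.Product using (Σ; ∃-syntax; _×_; _,_; proj₁; proj₂)
open import Data.Sum as Sum using (_⊎_; inj₁; inj₂; swap) renaming ([_,_] to either)
open import Data.Empty using (⊥-elim)
open import Function.Bundles using (_⇔_; mk⇔; Equivalence)
open import Relation.Unary using (Decidable)
open import Relation.Nullary using (¬_; Dec; yes; no; does)
open import Relation.Nullary.Decidable using (dec-true; dec-false; does-⇔; map′; _×-dec_; _⊎-dec_)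
open import Relation.Binary.PropositionalEquality
  using (_≡_; refl; sym; trans; cong; cong₂; subst; module ≡-Reasoning)
open import Algebra.Bundles using (CommutativeRing)

-- Sums modulo 2 are sums in the Boolean ring (xor, ∧).
open CommutativeRing xor-∧-commutativeRing using (semiring)
open import Algebra.Properties.Semiring.Sum semiring
  using (sum-syntax; sum-cong-≗; sum-remove; sum-replicate-zero; ∑-distrib-+; *-distribˡ-sum)

does-true⇒ : ∀ {p} {P : Set p} (P? : Dec P) → does P? ≡ true → P
does-true⇒ (yes p) _ = p

odd? : ℕ → Bool
odd? zero    = false
odd? (suc m) = not (odd? m)

odd?-double : ∀ k → odd? (k + k) ≡ false
odd?-double zero = refl
odd?-double (suc k) rewrite +-suc k k | odd?-double k = refl

Odd⇒odd? : ∀ {m} → Odd m → odd? m ≡ true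
Odd⇒odd? (k , refl) rewrite +-identityʳ k | odd?-double k = refl

odd?⇒Odd : ∀ m → odd? m ≡ true → Odd m
odd?⇒Odd (suc zero)    _ = 0 , refl
odd?⇒Odd (suc (suc m)) e with odd?⇒Odd m (trans (sym (not-involutive (odd? m))) e)
... | k , refl = suc k , cong (λ j → suc (suc j)) (sym (+-suc k (k + 0)))

_∈?_ : ∀ {n} (z : Fin n) (L : List (Fin n)) → Dec (z ∈ L)
_∈?_ {n} = DecMembership._∈?_ (_≟_ {n})

sum-single : ∀ {m} (f : Fin m → Bool) (a : Fin m) → (∀ i → f i ≡ true → i ≡ a) → ∑[ i < m ] f i ≡ f a
sum-single {suc m} f a single = begin
  ∑[ i < suc m ] f i                 ≡⟨ sum-remove {i = a} f ⟩
  f a xor ∑[ j < m ] f (punchIn a j) ≡⟨ cong (f a xor_) (sum-cong-≗ vanish) ⟩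
  f a xor ∑[ j < m ] false           ≡⟨ cong (f a xor_) (sum-replicate-zero m) ⟩
  f a xor false                      ≡⟨ xor-identityʳ (f a) ⟩
  f a                                ∎
  where
  open ≡-Reasoning
  vanish : ∀ j → f (punchIn a j) ≡ false
  vanish j = ¬-not (λ fj → punchInᵢ≢i a j (single _ fj))

sum₂-single : ∀ {m k} (M : Fin m → Fin k → Bool) (a : Fin m) (b : Fin k)
            → (∀ i j → M i j ≡ true → i ≡ a × j ≡ b)
            → ∑[ i < m ] ∑[ j < k ] M i j ≡ M a b
sum₂-single M a b single =
  trans (sum-cong-≗ (λ i → sum-single (M i) b (λ j e → proj₂ (single i j e))))
        (sum-single (λ i → M i b) a (λ i e → proj₁ (single i b e)))

-- A symmetric Boolean matrix with zero diagonal has even total sum: the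
-- off-diagonal entries come in equal pairs.
sum-symmetric : ∀ {m} (M : Fin m → Fin m → Bool)
              → (∀ i j → M i j ≡ M j i) → (∀ i → M i i ≡ false)
              → ∑[ i < m ] ∑[ j < m ] M i j ≡ false
sum-symmetric {zero}  M _     _    = refl
sum-symmetric {suc m} M M-sym diag = begin
  (M zero zero xor row) xor ∑[ i < m ] (M (suc i) zero xor ∑[ j < m ] M (suc i) (suc j))
    ≡⟨ cong₂ (λ x y → (x xor row) xor y) (diag zero) (∑-distrib-+ (λ i → M (suc i) zero) _) ⟩
  row xor (∑[ i < m ] M (suc i) zero xor ∑[ i < m ] ∑[ j < m ] M (suc i) (suc j))
    ≡⟨ cong₂ (λ x y → row xor (x xor y)) (sum-cong-≗ (λ i → M-sym (suc i) zero)) minor ⟩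
  row xor (row xor false)
    ≡⟨ cong (row xor_) (xor-identityʳ row) ⟩
  row xor row
    ≡⟨ xor-same row ⟩
  false ∎
  where
  open ≡-Reasoning
  row : Bool
  row = ∑[ j < m ] M zero (suc j)
  minor : ∑[ i < m ] ∑[ j < m ] M (suc i) (suc j) ≡ false
  minor = sum-symmetric (λ i j → M (suc i) (suc j)) (λ i j → M-sym (suc i) (suc j)) (λ i → diag (suc i))

split-by : ∀ x y z → x ∧ z ≡ (x ∧ y ∧ z) xor (x ∧ not y ∧ z)
split-by false _     _ = refl
split-by true  true  z = sym (xor-identityʳ z)
split-by true  false z = refl

-- Handshake lemma relative to a set s.  Let r be the adjacency matrix of a graph on
-- Fin m in which every degree is odd.  Then |s| ≡ number of edges from s to its
-- complement (mod 2): expand |s| = Σ_{u ∈ s} deg u and drop the edges inside s,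
-- which are counted twice.
cut-parity : ∀ {m} (r : Fin m → Fin m → Bool)
           → (∀ u w → r u w ≡ r w u) → (∀ u → r u u ≡ false)
           → (∀ u → ∑[ w < m ] r u w ≡ true)
           → (s : Fin m → Bool)
           → ∑[ u < m ] s u ≡ ∑[ u < m ] ∑[ w < m ] (s u ∧ not (s w) ∧ r u w)
cut-parity {m} r r-sym r-irrefl odd-rows s = begin
  ∑[ u < m ] s u
    ≡⟨ sum-cong-≗ (λ u → sym (trans (cong (s u ∧_) (odd-rows u)) (∧-identityʳ (s u)))) ⟩
  ∑[ u < m ] (s u ∧ ∑[ w < m ] r u w)
    ≡⟨ sum-cong-≗ (λ u → *-distribˡ-sum (s u) (r u)) ⟩
  ∑[ u < m ] ∑[ w < m ] (s u ∧ r u w)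
    ≡⟨ sum-cong-≗ (λ u → sum-cong-≗ (λ w → split-by (s u) (s w) (r u w))) ⟩
  ∑[ u < m ] ∑[ w < m ] (inside u w xor crossing u w)
    ≡⟨ sum-cong-≗ (λ u → ∑-distrib-+ (inside u) (crossing u)) ⟩
  ∑[ u < m ] (∑[ w < m ] inside u w xor ∑[ w < m ] crossing u w)
    ≡⟨ ∑-distrib-+ (λ u → ∑[ w < m ] inside u w) (λ u → ∑[ w < m ] crossing u w) ⟩
  ∑[ u < m ] ∑[ w < m ] inside u w xor ∑[ u < m ] ∑[ w < m ] crossing u w
    ≡⟨ cong (_xor ∑[ u < m ] ∑[ w < m ] crossing u w) (sum-symmetric inside inside-sym inside-diag) ⟩
  ∑[ u < m ] ∑[ w < m ] crossing u w ∎
  where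
  open ≡-Reasoning
  inside crossing : Fin m → Fin m → Bool
  inside   u w = s u ∧ s w ∧ r u w
  crossing u w = s u ∧ not (s w) ∧ r u w
  inside-sym : ∀ u w → inside u w ≡ inside w u
  inside-sym u w with s u | s w
  ... | true  | true  = r-sym u w
  ... | true  | false = refl
  ... | false | true  = refl
  ... | false | false = refl
  inside-diag : ∀ u → inside u u ≡ false
  inside-diag u with s u
  ... | true  = r-irrefl u
  ... | false = refl

∨-disjoint : ∀ a b → (a ≡ true → b ≡ false) → a ∨ b ≡ a xor b
∨-disjoint true  b disj = cong not (sym (disj refl))
∨-disjoint false b _    = refl

length-parity : ∀ {m} (L : List (Fin m)) → Unique L → odd? (length L) ≡ ∑[ z < m ] does (z ∈? L)
length-parity {m} []      []             = sym (sum-replicate-zero m)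
length-parity {m} (x ∷ L) (x∉L ∷ unique) = begin
  not (odd? (length L))
    ≡⟨ cong not (length-parity L unique) ⟩
  true xor ∑[ z < m ] does (z ∈? L)
    ≡⟨ cong (_xor ∑[ z < m ] does (z ∈? L)) (sym count-x) ⟩
  ∑[ z < m ] does (z ≟ x) xor ∑[ z < m ] does (z ∈? L)
    ≡⟨ sym (∑-distrib-+ (λ z → does (z ≟ x)) (λ z → does (z ∈? L))) ⟩
  ∑[ z < m ] (does (z ≟ x) xor does (z ∈? L))
    ≡⟨ sum-cong-≗ (λ z → sym (∨-disjoint (does (z ≟ x)) (does (z ∈? L)) (x-not-in-L z))) ⟩
  ∑[ z < m ] does (z ∈? (x ∷ L)) ∎
  where
  open ≡-Reasoning
  x-not-in-L : ∀ z → does (z ≟ x) ≡ true → does (z ∈? L) ≡ false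
  x-not-in-L z z≡x = dec-false (z ∈? L) (λ z∈L → lookup x∉L z∈L (sym (does-true⇒ (z ≟ x) z≡x)))
  count-x : ∑[ z < m ] does (z ≟ x) ≡ true
  count-x = trans (sum-single (λ z → does (z ≟ x)) x (λ z e → does-true⇒ (z ≟ x) e)) (dec-true (x ≟ x) refl)

enumerate : ∀ {m} {P : Fin m → Set} → Decidable P
          → Σ (List (Fin m)) λ L → Unique L × (∀ z → (z ∈ L) ⇔ P z)
enumerate {m} P? =
  filter P? (allFin m) , filter⁺ P? (allFin⁺ m) ,
  λ z → mk⇔ (λ z∈L → proj₂ (∈-filter⁻ P? {xs = allFin m} z∈L)) (∈-filter⁺ P? (∈-allFin z))

count-parity : ∀ {m} {P : Fin m → Set} (P? : Decidable P) (L : List (Fin m))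
             → Unique L → (∀ z → (z ∈ L) ⇔ P z)
             → odd? (length L) ≡ ∑[ z < m ] does (P? z)
count-parity P? L unique members =
  trans (length-parity L unique) (sum-cong-≗ (λ z → does-⇔ (members z) (z ∈? L) (P? z)))

module _ {A : Set} where

  after : ∀ {u : A} (L : List A) → u ∈ L → List A
  after (_ ∷ L) (here _)  = L
  after (_ ∷ L) (there p) = after L p

  after-unique : ∀ {u : A} (L : List A) (p : u ∈ L) → Unique L → Unique (u ∷ after L p)
  after-unique (_ ∷ L) (here refl) unique       = unique
  after-unique (_ ∷ L) (there p)   (_ ∷ unique) = after-unique L p unique

  after-linked : ∀ {R : A → A → Set} {u : A} (L : List A) (p : u ∈ L)
               → Linked R L → Linked R (u ∷ after L p)
  after-linked (_ ∷ L) (here refl) linked = linked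
  after-linked (_ ∷ L) (there p)   linked = after-linked L p (Linked.tail linked)

  after-last : ∀ {u : A} (L : List A) (p : u ∈ L) → last L ≡ last (u ∷ after L p)
  after-last (_ ∷ L)     (here refl) = refl
  after-last (_ ∷ y ∷ L) (there p)   = after-last (y ∷ L) p

module _ {n : ℕ} where

  sameEdge? : ∀ a b x y → Dec (SameEdge {n} a b x y)
  sameEdge? a b x y = ((x ≟ a) ×-dec (y ≟ b)) ⊎-dec ((x ≟ b) ×-dec (y ≟ a))

  reach-snoc : ∀ {G : Graph n} {u v w} → Reach G u v → Adj G v w → Reach G u w
  reach-snoc here       e = step e here
  reach-snoc (step d r) e = step d (reach-snoc r e)

  reach-trans : ∀ {G : Graph n} {u v w} → Reach G u v → Reach G v w → Reach G u w
  reach-trans here       r' = r'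
  reach-trans (step e r) r' = step e (reach-trans r r')

  reach-sym : ∀ {G : Graph n} {u v} → Reach G u v → Reach G v u
  reach-sym         here       = here
  reach-sym {G = G} (step e r) = reach-snoc (reach-sym r) (Graph.sym G e)

  reach-map : ∀ {G H : Graph n} → (∀ {x y} → Adj G x y → Adj H x y)
            → ∀ {u v} → Reach G u v → Reach H u v
  reach-map f here       = here
  reach-map f (step e r) = step (f e) (reach-map f r)

  record Path (G : Graph n) (u w : Fin n) : Set where
    constructor path
    field
      rest     : List (Fin n)
      distinct : Unique (u ∷ rest)
      linked   : Linked (Adj G) (u ∷ rest)
      ends     : last (u ∷ rest) ≡ just w

  -- Every walk can be shortened to a path (erase loops by cutting at a repeated vertex).
  walk⇒path : ∀ {G : Graph n} {u w} → Reach G u w → Path G u w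
  walk⇒path here = path [] ([] ∷ []) [-] refl
  walk⇒path {u = u} (step {v = v} e r) with walk⇒path r
  ... | path zs distinct linked ends with u ∈? (v ∷ zs)
  ...   | no  u∉ = path (v ∷ zs) (¬Any⇒All¬ (v ∷ zs) u∉ ∷ distinct) (e ∷ linked) ends
  ...   | yes u∈ = path (after (v ∷ zs) u∈) (after-unique (v ∷ zs) u∈ distinct)
                        (after-linked (v ∷ zs) u∈ linked) (trans (sym (after-last (v ∷ zs) u∈)) ends)

  same-component : ∀ {G : Graph n} {x x'} → Reach G x x' → ∀ y → Reach G x' y ⇔ Reach G x y
  same-component xx' y = mk⇔ (reach-trans xx') (reach-trans (reach-sym xx'))

  delete-swap : ∀ {G : Graph n} {a b u v} → Reach (deleteEdge G a b) u v → Reach (deleteEdge G b a) u v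
  delete-swap = reach-map λ (e , not-ab) → e , λ ba → not-ab (swap ba)

  delete-swap⇔ : ∀ {G : Graph n} {a b x} y → Reach (deleteEdge G a b) x y ⇔ Reach (deleteEdge G b a) x y
  delete-swap⇔ y = mk⇔ delete-swap delete-swap

  oddComponent-resp : ∀ {G H : Graph n} {x x'} → (∀ y → Reach G x y ⇔ Reach H x' y)
                    → OddComponent G x → OddComponent H x'
  oddComponent-resp same (L , unique , members , odd) =
    L , unique , (λ y → mk⇔ (λ y∈L → Equivalence.to (same y) (Equivalence.to (members y) y∈L))
                            (λ y∼x' → Equivalence.from (members y) (Equivalence.from (same y) y∼x'))) , odd

  oddComponent⇔ : ∀ {G : Graph n} {x} (reach? : Decidable (Reach G x))
                → OddComponent G x ⇔ (∑[ y < n ] does (reach? y) ≡ true)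
  oddComponent⇔ reach? = mk⇔
    (λ (L , unique , members , odd) → trans (sym (count-parity reach? L unique members)) (Odd⇒odd? odd))
    (λ total → let (L , unique , members) = enumerate reach? in
               L , unique , members , odd?⇒Odd (length L) (trans (count-parity reach? L unique members) total))

  SameAdjacency : Graph n → Graph n → Set
  SameAdjacency G H = ∀ u w → Adj G u w ⇔ Adj H u w

  degree-resp : ∀ {G H : Graph n} {x d} → SameAdjacency G H → HasDeg G x d → HasDeg H x d
  degree-resp same (L , unique , members , len) =
    L , unique , (λ y → mk⇔ (λ y∈L → Equivalence.to (same _ y) (Equivalence.to (members y) y∈L))
                            (λ xy → Equivalence.from (members y) (Equivalence.from (same _ y) xy))) , len

  caterpillar-resp : ∀ {G H : Graph n} → SameAdjacency G H
                   → ∀ v → IsOddCaterpillarComponent G v → IsOddCaterpillarComponent H v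
  caterpillar-resp {G} {H} same v
    ((u′ , w , v∼u′ , u′w) , (P , nonempty , distinct , linked , inside , consecutive , leaves) , odd) =
    (u′ , w , reach-map to v∼u′ , to u′w) ,
    (P , nonempty , distinct , Linked.map to linked , All.map (reach-map to) inside ,
     (λ a b a∈P b∈P ab → consecutive a b a∈P b∈P (from ab)) ,
     λ u v∼u u∉P → let (leaf , w , w∈P , uw) = leaves u (reach-map from v∼u) u∉P
                   in degree-resp {G} {H} same leaf , w , w∈P , to uw) ,
    λ u d v∼u deg 2≤d → odd u d (reach-map from v∼u) (degree-resp {H} {G} flipped deg) 2≤d
    where
    to : ∀ {x y} → Adj G x y → Adj H x y
    to {x} {y} = Equivalence.to (same x y)
    from : ∀ {x y} → Adj H x y → Adj G x y
    from {x} {y} = Equivalence.from (same x y)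
    flipped : SameAdjacency H G
    flipped x y = mk⇔ from to

module TreeEdge {n : ℕ} (T : Graph n) (tree : IsTree T) {a b : Fin n} (ab : Adj T a b) where

  D : Graph n
  D = deleteEdge T a b

  -- A walk from a to b in T - ab shortens to a path which, closed up by ab, would be
  -- a cycle of T (paths with fewer than two inner steps are excluded directly).
  bridge : ¬ Reach D a b
  bridge a∼b with walk⇒path a∼b
  ... | path [] _ _ ends = irrefl T (subst (Adj T a) (sym (just-injective ends)) ab)
  ... | path (z ∷ []) _ ((_ , not-ab) ∷ [-]) ends = not-ab (inj₁ (refl , just-injective ends))
  ... | path zs@(_ ∷ _ ∷ _) distinct linked ends =
    proj₂ tree (a , zs , s≤s (s≤s z≤n) , distinct , ++⁺ (Linked.map proj₁ linked) closing [-])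
    where
    closing : Maybe.Connected (Adj T) (last (a ∷ zs)) (just a)
    closing = subst (λ m → Maybe.Connected (Adj T) m (just a)) (sym ends) (just (Graph.sym T ab))

  -- Follow a walk of T towards a until it first uses the edge ab.
  toward-edge : ∀ {x} → Reach T x a → Reach D x a ⊎ Reach D x b
  toward-edge here = inj₁ here
  toward-edge {x} (step {v = v} e r) with sameEdge? a b x v
  ... | yes (inj₁ (refl , refl)) = inj₁ here
  ... | yes (inj₂ (refl , refl)) = inj₂ here
  ... | no  not-ab = Sum.map (step (e , not-ab)) (step (e , not-ab)) (toward-edge r)

  sides : ∀ y → Reach D a y ⊎ Reach D b y
  sides y = Sum.map reach-sym reach-sym (toward-edge (proj₁ tree y a))

  side? : Decidable (Reach D a)
  side? y with sides y
  ... | inj₁ a∼y = yes a∼y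
  ... | inj₂ b∼y = no (λ a∼y → bridge (reach-trans a∼y (reach-sym b∼y)))

  crossing : ∀ {u w} → Reach D a u → ¬ Reach D a w → Adj T u w → u ≡ a × w ≡ b
  crossing {u} {w} a∼u a≁w e with sameEdge? a b u w
  ... | yes (inj₁ u≡a×w≡b)  = u≡a×w≡b
  ... | yes (inj₂ (refl , _)) = ⊥-elim (bridge a∼u)
  ... | no  not-ab = ⊥-elim (a≁w (reach-snoc a∼u (e , not-ab)))

module OddFactorOfTree {n : ℕ} (T : Graph n) (tree : IsTree T) (F : Graph n)
  (F⊆T : SpanningSubgraph F T) (adj? : ∀ u w → Dec (Adj F u w))
  (odd-degrees : ∀ u d → HasDeg F u d → Odd d) where

  adjᵇ : Fin n → Fin n → Bool
  adjᵇ u w = does (adj? u w)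

  adjᵇ-sym : ∀ u w → adjᵇ u w ≡ adjᵇ w u
  adjᵇ-sym u w = does-⇔ (mk⇔ (Graph.sym F) (Graph.sym F)) (adj? u w) (adj? w u)

  adjᵇ-irrefl : ∀ u → adjᵇ u u ≡ false
  adjᵇ-irrefl u = dec-false (adj? u u) (irrefl F)

  degree-odd : ∀ u → ∑[ w < n ] adjᵇ u w ≡ true
  degree-odd u =
    let (L , unique , members) = enumerate (adj? u) in
    trans (sym (count-parity (adj? u) L unique members))
          (Odd⇒odd? (odd-degrees u (length L) (L , unique , members , refl)))

  side-parity : ∀ {a b} (ab : Adj T a b) → ∑[ y < n ] does (TreeEdge.side? T tree ab y) ≡ adjᵇ a b
  side-parity {a} {b} ab = begin
    ∑[ y < n ] s y
      ≡⟨ cut-parity adjᵇ adjᵇ-sym adjᵇ-irrefl degree-odd s ⟩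
    ∑[ u < n ] ∑[ w < n ] (s u ∧ not (s w) ∧ adjᵇ u w)
      ≡⟨ sum₂-single (λ u w → s u ∧ not (s w) ∧ adjᵇ u w) a b only-ab ⟩
    s a ∧ not (s b) ∧ adjᵇ a b
      ≡⟨ cong₂ (λ x y → x ∧ not y ∧ adjᵇ a b) (dec-true (side? a) here) (dec-false (side? b) bridge) ⟩
    adjᵇ a b ∎
    where
    open ≡-Reasoning
    open TreeEdge T tree ab
    s : Fin n → Bool
    s y = does (side? y)
    only-ab : ∀ u w → s u ∧ not (s w) ∧ adjᵇ u w ≡ true → u ≡ a × w ≡ b
    only-ab u w e with side? u | side? w | adj? u w
    ... | yes a∼u | no a≁w | yes uw = crossing a∼u a≁w (F⊆T uw)
    ... | yes _   | yes _  | _      with () ← e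
    ... | yes _   | no _   | no _   with () ← e
    ... | no _    | _      | _      with () ← e

  odd-side : ∀ {a b} (ab : Adj T a b) → OddComponent (deleteEdge T a b) a ⇔ Adj F a b
  odd-side {a} {b} ab = mk⇔
    (λ odd → does-true⇒ (adj? a b) (trans (sym (side-parity ab)) (Equivalence.to (oddComponent⇔ side?) odd)))
    (λ e → Equivalence.from (oddComponent⇔ side?) (trans (side-parity ab) (dec-true (adj? a b) e)))
    where open TreeEdge T tree ab

  -- If ab ∈ F both sides are odd (apply
  -- `odd-side` to ab and to ba); conversely any odd component is one of the two
  -- sides, and either one being odd forces ab ∈ F.
  edge-criterion : ∀ {a b} (ab : Adj T a b) → Adj F a b ⇔ HasTwoOddComponents (deleteEdge T a b)
  edge-criterion {a} {b} ab = mk⇔ two-odd-sides from-odd-component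
    where
    open TreeEdge T tree ab
    ba : Adj T b a
    ba = Graph.sym T ab
    odd-b-side : Adj F a b → OddComponent (deleteEdge T a b) b
    odd-b-side e = oddComponent-resp delete-swap⇔ (Equivalence.from (odd-side ba) (Graph.sym F e))
    two-odd-sides : Adj F a b → HasTwoOddComponents (deleteEdge T a b)
    two-odd-sides e = a , b , bridge , Equivalence.from (odd-side ab) e , odd-b-side e
    from-odd-component : HasTwoOddComponents (deleteEdge T a b) → Adj F a b
    from-odd-component (x , _ , _ , odd-x , _) with sides x
    ... | inj₁ a∼x = Equivalence.to (odd-side ab) (oddComponent-resp (same-component a∼x) odd-x)
    ... | inj₂ b∼x = Graph.sym F (Equivalence.to (odd-side ba)
                       (oddComponent-resp delete-swap⇔ (oddComponent-resp (same-component b∼x) odd-x)))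

  odd-factor-edges : SameAdjacency F (oddCutSubgraph T)
  odd-factor-edges u w = mk⇔ (λ uw → F⊆T uw , Equivalence.to (edge-criterion (F⊆T uw)) uw)
                             (λ (uw , two-odd) → Equivalence.from (edge-criterion uw) two-odd)

module _ {n : ℕ} where

  consecutive-here : ∀ {x y : Fin n} {L : List (Fin n)} {a b}
                   → SameEdge a b x y → Consecutive (x ∷ y ∷ L) a b
  consecutive-here {L = L} (inj₁ (refl , refl)) = [] , L , inj₁ refl
  consecutive-here {L = L} (inj₂ (refl , refl)) = [] , L , inj₂ refl

  consecutive-∷ : ∀ {x : Fin n} {L a b} → Consecutive L a b → Consecutive (x ∷ L) a b
  consecutive-∷ {x} (xs , ys , eq) = x ∷ xs , ys , Sum.map (cong (x ∷_)) (cong (x ∷_)) eq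

  consecutive-drop : ∀ {x z : Fin n} {L xs ys a b}
                   → (x ∷ L ≡ z ∷ xs ++ a ∷ b ∷ ys ⊎ x ∷ L ≡ z ∷ xs ++ b ∷ a ∷ ys)
                   → Consecutive L a b
  consecutive-drop {xs = xs} {ys} eq = xs , ys , Sum.map ∷-injectiveʳ ∷-injectiveʳ eq

  consecutive-inv : ∀ {x y : Fin n} {L a b} → Consecutive (x ∷ y ∷ L) a b
                  → SameEdge a b x y ⊎ Consecutive (y ∷ L) a b
  consecutive-inv ([] , _ , inj₁ refl) = inj₁ (inj₁ (refl , refl))
  consecutive-inv ([] , _ , inj₂ refl) = inj₁ (inj₂ (refl , refl))
  consecutive-inv (_ ∷ _ , _ , eq)     = inj₂ (consecutive-drop eq)

  no-consecutive-[] : ∀ {a b : Fin n} → ¬ Consecutive [] a b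
  no-consecutive-[] ([]    , _ , inj₁ ())
  no-consecutive-[] ([]    , _ , inj₂ ())
  no-consecutive-[] (_ ∷ _ , _ , inj₁ ())
  no-consecutive-[] (_ ∷ _ , _ , inj₂ ())

  no-consecutive-[x] : ∀ {x a b : Fin n} → ¬ Consecutive [ x ] a b
  no-consecutive-[x] ([]    , _ , inj₁ ())
  no-consecutive-[x] ([]    , _ , inj₂ ())
  no-consecutive-[x] (_ ∷ _ , _ , eq) = no-consecutive-[] (consecutive-drop eq)

  consecutive? : ∀ P a b → Dec (Consecutive P a b)
  consecutive? []          a b = no no-consecutive-[]
  consecutive? (x ∷ [])    a b = no no-consecutive-[x]
  consecutive? (x ∷ y ∷ L) a b =
    map′ (either consecutive-here consecutive-∷) consecutive-inv
         (sameEdge? a b x y ⊎-dec consecutive? (y ∷ L) a b)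

  consecutive-related : ∀ {R : Fin n → Fin n → Set} → (∀ {x y} → R x y → R y x)
                      → ∀ P {a b} → Linked R P → Consecutive P a b → R a b
  consecutive-related R-sym []          _             c = ⊥-elim (no-consecutive-[] c)
  consecutive-related R-sym (x ∷ [])    _             c = ⊥-elim (no-consecutive-[x] c)
  consecutive-related {R} R-sym (x ∷ y ∷ L) (xy ∷ linked) c =
    either (edge-related xy) (consecutive-related R-sym (y ∷ L) linked) (consecutive-inv c)
    where
    edge-related : ∀ {x y a b} → R x y → SameEdge a b x y → R a b
    edge-related xy (inj₁ (refl , refl)) = xy
    edge-related xy (inj₂ (refl , refl)) = R-sym xy

  -- A leaf has a unique neighbour; so adjacency to a leaf is decided by comparing
  -- with any one known neighbour.
  leaf-unique : ∀ (F : Graph n) {x p q} → HasDeg F x 1 → Adj F x p → Adj F x q → p ≡ q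
  leaf-unique F {p = p} {q} (w ∷ [] , _ , members , refl) xp xq
    with Equivalence.from (members p) xp | Equivalence.from (members q) xq
  ... | here refl | here refl = refl

  decide-by-leaf : ∀ (F : Graph n) {x y c} → Adj F x c → (Adj F x y → HasDeg F x 1) → Dec (Adj F x y)
  decide-by-leaf F {y = y} {c} xc leaf-if with y ≟ c
  ... | yes refl = yes xc
  ... | no  y≢c  = no (λ xy → y≢c (leaf-unique F (leaf-if xy) xy xc))

-- In an odd caterpillar factor adjacency is decidable (the spine is a path and
-- every other vertex is a leaf) and every degree is odd (degree 0 is excluded since
-- each vertex lies in a component with an edge, degree 1 is odd, and degrees ≥ 2
-- are odd by definition).
module OddCaterpillarFactor {n : ℕ} (F : Graph n) (caterpillar : ∀ v → IsOddCaterpillarComponent F v) where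

  neighbour : ∀ u → ∃[ w ] Adj F u w
  neighbour u with proj₁ (caterpillar u)
  ... | _ , w , here     , uw = w , uw
  ... | _ , _ , step e _ , _  = _ , e

  adj? : ∀ u z → Dec (Adj F u z)
  adj? u z with proj₁ (proj₂ (caterpillar u))
  ... | P , _ , _ , linked , _ , consecutive , leaves with u ∈? P | z ∈? P
  ... | no  u∉P | _       = decide-by-leaf F (proj₂ (neighbour u)) (λ _ → proj₁ (leaves u here u∉P))
  ... | yes u∈P | yes z∈P = map′ (consecutive-related (Graph.sym F) P linked) (consecutive u z u∈P z∈P)
                                 (consecutive? P u z)
  ... | yes _   | no  z∉P = map′ (Graph.sym F) (Graph.sym F)
                                 (decide-by-leaf F (proj₂ (neighbour z))
                                    (λ zu → proj₁ (leaves z (step (Graph.sym F zu) here) z∉P)))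

  odd-degrees : ∀ u d → HasDeg F u d → Odd d
  odd-degrees u zero ([] , _ , members , _) with () ← Equivalence.from (members _) (proj₂ (neighbour u))
  odd-degrees u (suc zero)    _   = 0 , refl
  odd-degrees u (suc (suc d)) deg = proj₂ (proj₂ (caterpillar u)) u (suc (suc d)) here deg (s≤s (s≤s z≤n))

mainTheorem13 : (n : ℕ) (T : Graph n) → IsTree T →
                HasOddCaterpillarFactor T ⇔ IsOddCaterpillarFactor T (oddCutSubgraph T)
mainTheorem13 n T tree = mk⇔ canonical (λ factor → oddCutSubgraph T , factor)
  where
  canonical : HasOddCaterpillarFactor T → IsOddCaterpillarFactor T (oddCutSubgraph T)
  canonical (F , F⊆T , caterpillar) =
    proj₁ , λ v → caterpillar-resp odd-factor-edges v (caterpillar v)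
    where
    open OddCaterpillarFactor F caterpillar
    open OddFactorOfTree T tree F F⊆T adj? odd-degrees
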